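{- Let $r$ and $n$ be positive integers with $n\ge 2r$, and let $m$ be an integer with $0\le m\le 4$. Then $$\sum_{i=0}^{m} d_n^+(2i)\ \ge\ \sum_{i=0}^{m} d_n^-(2r-2i).$$
   Context: Let $\mathcal{P}$ be the set of odd primes and $\mathcal{E}_n=\{0,2,4,\dots,2n\}$. $\overrightarrow{\mathcal{G}}_n$ is the directed graph with vertex set $\mathcal{E}_n$ and an arc $a\to b$ iff $\frac{a+b}{2}\in\mathcal{P}$ and $\frac{b-a}{2}\in\mathcal{P}$. For $v\in\mathcal{E}_n$, $d_n^+(v)$ is the number of $w\in\mathcal{E}_n$ with $v\to w$ and $d_n^-(v)$ the number of $u\in\mathcal{E}_n$ with $u\to v$. By convention $d_n^-(v)=0$ if $v<0$. -}

module Defs where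

open import Data.Nat using (ℕ; zero; suc; _+_; _∸_; _<_; _≤_; _≤?_; _<?_; _≟_)
open import Data.Nat.Primality using (Prime; prime?)
open import Data.List using (List; length; filter; upTo; map)
open import Data.Nat.ListAction using (sum)
open import Data.Product using (_×_)
open import Relation.Nullary using (¬_; Dec; yes; no)
open import Relation.Nullary.Decidable using (_×-dec_; ¬?)
open import Relation.Binary.PropositionalEquality using (_≡_)

OddPrime : ℕ → Set
OddPrime p = Prime p × ¬ (p ≡ 2)

oddPrime? : (p : ℕ) → Dec (OddPrime p)
oddPrime? p = prime? p ×-dec ¬? (p ≟ 2)

-- Vertices of G_n are the even numbers 2k, 0 ≤ k ≤ n; we index a vertex 2k by k.
-- Arc (2a) → (2b)  iff  (2a+2b)/2 = a+b ∈ P  and  (2b-2a)/2 = b-a ∈ P.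
-- (b - a prime forces a < b, so the natural subtraction is guarded by a < b.)
Arc : ℕ → ℕ → Set
Arc a b = OddPrime (a + b) × (a < b × OddPrime (b ∸ a))

arc? : (a b : ℕ) → Dec (Arc a b)
arc? a b = oddPrime? (a + b) ×-dec ((a <? b) ×-dec oddPrime? (b ∸ a))

vertices : ℕ → List ℕ
vertices n = upTo (suc n)

-- d⁺ n k = d_n^+(2k) : number of w ∈ E_n with 2k → w
outdeg : ℕ → ℕ → ℕ
outdeg n k = length (filter (λ w → arc? k w) (vertices n))

-- d⁻ n k = d_n^-(2k) : number of u ∈ E_n with u → 2k
indeg : ℕ → ℕ → ℕ
indeg n k = length (filter (λ u → arc? u k) (vertices n))

-- d_n^-(2r - 2i), with the convention d_n^-(v) = 0 for v < 0
indegShift : ℕ → ℕ → ℕ → ℕ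
indegShift n r i with i ≤? r
... | yes _ = indeg n (r ∸ i)
... | no _  = 0

sumTo : ℕ → (ℕ → ℕ) → ℕ
sumTo m f = sum (map f (upTo (suc m)))

-- An arc 2u → 2v is a pair of odd primes v ∓ u.  Count the arcs into 2r, 2r − 2, …, 2r − 2m
-- and the arcs out of 0, 2, …, 2m, and inject the former into the latter.  An in-arc
-- 2u → 2(r − i) with u ≤ m is itself an out-arc.  Otherwise, with primes q < p, it is sent to
-- an out-arc out of 0, 2 or 4 that shares q or p; which one depends on whether p + 4, p + 8,
-- q + 4 or q − 4 are prime, and the fact that 3, 5, 7 is the only prime triple p, p + 2, p + 4
-- keeps the choices apart.  Injectivity holds because the map has a left inverse: from an
-- out-arc, test a fixed list of candidate in-arcs and return the first genuine one.

module Submission where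

open import Defs
open import Data.List using (List; []; _∷_; _++_; length; filter; map; upTo; cartesianProduct)
open import Data.List.Membership.Propositional using (_∈_)
open import Data.List.Membership.Propositional.Properties
  using (∈-filter⁺; ∈-filter⁻; ∈-map∘filter⁺; ∈-cartesianProduct⁺; ∈-cartesianProduct⁻; ∈-upTo⁺; ∈-upTo⁻)
open import Data.List.Properties using (filter-++; filter-notAll; length-++; length-map)
open import Data.List.Relation.Binary.Subset.Propositional using (_⊆_)
import Data.List.Relation.Unary.All as All
open import Data.List.Relation.Unary.Any as Any using (here; there)
open import Data.List.Relation.Unary.AllPairs using (_∷_)
open import Data.List.Relation.Unary.Unique.Propositional using (Unique)
open import Data.List.Relation.Unary.Unique.Propositional.Properties
  using (filter⁺; cartesianProduct⁺; upTo⁺)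
open import Data.Nat using (ℕ; suc; _+_; _*_; _∸_; _≤_; _<_; z≤n; s≤s; _≤?_; _≟_; >-nonZero⁻¹)
open import Data.Nat.Divisibility using (_∣_; divides; ∣-refl; ∣m∣n⇒∣m+n)
open import Data.Nat.ListAction using (sum)
open import Data.Nat.Primality using (Prime; prime⇒irreducible; prime⇒nonZero; ¬prime[1])
open import Data.Nat.Properties
open import Data.Nat.Tactic.RingSolver using (solve-∀)
open import Data.Product using (Σ-syntax; ∃-syntax; _×_; _,_; proj₁; proj₂)
open import Data.Product.Properties using (≡-dec)
open import Data.Sum as Sum using (_⊎_; inj₁; inj₂; [_,_]′)
open import Function using (_∘_; id)
open import Relation.Binary.Definitions using (DecidableEquality)
open import Relation.Binary.PropositionalEquality using (_≡_; refl; sym; trans; cong; cong₂; subst; module ≡-Reasoning)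
open import Relation.Nullary using (¬_; Dec; yes; no; contradiction)
open import Relation.Nullary.Decidable using (_×-dec_; ¬?; map′)
open import Relation.Unary using (Decidable)

sum-map-mono : ∀ {A : Set} {f g : A → ℕ} → (∀ x → f x ≤ g x) → ∀ xs → sum (map f xs) ≤ sum (map g xs)
sum-map-mono f≤g []       = z≤n
sum-map-mono f≤g (x ∷ xs) = +-mono-≤ (f≤g x) (sum-map-mono f≤g xs)

module _ {A B : Set} {P : B → Set} (P? : Decidable P) where

  length-filter-map : ∀ (f : A → B) xs → length (filter P? (map f xs)) ≡ length (filter (P? ∘ f) xs)
  length-filter-map f []       = refl
  length-filter-map f (x ∷ xs) with P? (f x)
  ... | yes _ = cong suc (length-filter-map f xs)
  ... | no _  = length-filter-map f xs

module _ {A B : Set} {P : A × B → Set} (P? : Decidable P) where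

  length-filter-cartesianProduct : ∀ xs ys →
    length (filter P? (cartesianProduct xs ys)) ≡ sum (map (λ x → length (filter (λ y → P? (x , y)) ys)) xs)
  length-filter-cartesianProduct []       ys = refl
  length-filter-cartesianProduct (x ∷ xs) ys = begin
    length (filter P? (map (x ,_) ys ++ cartesianProduct xs ys))
      ≡⟨ cong length (filter-++ P? (map (x ,_) ys) _) ⟩
    length (filter P? (map (x ,_) ys) ++ filter P? (cartesianProduct xs ys))
      ≡⟨ length-++ (filter P? (map (x ,_) ys)) ⟩
    length (filter P? (map (x ,_) ys)) + length (filter P? (cartesianProduct xs ys))
      ≡⟨ cong₂ _+_ (length-filter-map P? (x ,_) ys) (length-filter-cartesianProduct xs ys) ⟩
    _ ∎
    where open ≡-Reasoning

module _ {A : Set} (_≟ᴬ_ : DecidableEquality A) where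

  Unique∧⊆⇒length≤ : ∀ {xs ys : List A} → Unique xs → xs ⊆ ys → length xs ≤ length ys
  Unique∧⊆⇒length≤ {[]}     _                 _       = z≤n
  Unique∧⊆⇒length≤ {x ∷ xs} {ys} (x∉xs ∷ unique) x∷xs⊆ys = begin-strict
    length xs                              ≤⟨ Unique∧⊆⇒length≤ unique xs⊆ys-x ⟩
    length (filter (¬? ∘ (x ≟ᴬ_)) ys)      <⟨ filter-notAll (¬? ∘ (x ≟ᴬ_)) ys
                                                 (Any.map (λ x≡y x≢y → x≢y x≡y) (x∷xs⊆ys (here refl))) ⟩
    length ys                              ∎
    where
    open ≤-Reasoning
    xs⊆ys-x : xs ⊆ filter (¬? ∘ (x ≟ᴬ_)) ys
    xs⊆ys-x y∈xs = ∈-filter⁺ (¬? ∘ (x ≟ᴬ_)) (x∷xs⊆ys (there y∈xs)) (All.lookup x∉xs y∈xs)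

oddPrime⇒0< : ∀ {p} → OddPrime p → 0 < p
oddPrime⇒0< {p} (p-prime , _) = >-nonZero⁻¹ p {{prime⇒nonZero p-prime}}

3∣a⊎3∣2+a⊎3∣4+a : ∀ a → 3 ∣ a ⊎ 3 ∣ 2 + a ⊎ 3 ∣ 4 + a
3∣a⊎3∣2+a⊎3∣4+a 0 = inj₁ (divides 0 refl)
3∣a⊎3∣2+a⊎3∣4+a 1 = inj₂ (inj₁ (divides 1 refl))
3∣a⊎3∣2+a⊎3∣4+a 2 = inj₂ (inj₂ (divides 2 refl))
3∣a⊎3∣2+a⊎3∣4+a (suc (suc (suc a))) =
  Sum.map 3∣3+ (Sum.map 3∣3+ 3∣3+) (3∣a⊎3∣2+a⊎3∣4+a a)
  where 3∣3+ : ∀ {n} → 3 ∣ n → 3 ∣ 3 + n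
        3∣3+ = ∣m∣n⇒∣m+n ∣-refl

3∣prime⇒≡3 : ∀ {p} → Prime p → 3 ∣ p → 3 ≡ p
3∣prime⇒≡3 p-prime 3∣p = [ (λ ()) , id ]′ (prime⇒irreducible p-prime 3∣p)

oddPrimeTriple⇒≡3 : ∀ {a} → OddPrime a → OddPrime (2 + a) → OddPrime (4 + a) → a ≡ 3
oddPrimeTriple⇒≡3 {a} (a-prime , _) (a+2-prime , _) (a+4-prime , _) with 3∣a⊎3∣2+a⊎3∣4+a a
... | inj₁ 3∣a               = sym (3∣prime⇒≡3 a-prime 3∣a)
... | inj₂ (inj₁ 3∣a+2) with refl ← 3∣prime⇒≡3 a+2-prime 3∣a+2 = contradiction a-prime ¬prime[1]
... | inj₂ (inj₂ 3∣a+4)      = contradiction (3∣prime⇒≡3 a+4-prime 3∣a+4) λ ()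

[k+[q+u]]∸q≡k+u : ∀ k q u → k + (q + u) ∸ q ≡ k + u
[k+[q+u]]∸q≡k+u k q u = trans (cong (_∸ q) (exchange k q u)) (m+n∸m≡n q (k + u))
  where exchange : ∀ k q u → k + (q + u) ≡ q + (k + u)
        exchange = solve-∀

[k+[q+u]]∸q+[k+[q+u]]≡[k+k]+[q+u+u] : ∀ k q u → k + (q + u) ∸ q + (k + (q + u)) ≡ (k + k) + (q + u + u)
[k+[q+u]]∸q+[k+[q+u]]≡[k+k]+[q+u+u] k q u =
  trans (cong (_+ (k + (q + u))) ([k+[q+u]]∸q≡k+u k q u)) (regroup k q u)
  where regroup : ∀ k q u → k + u + (k + (q + u)) ≡ (k + k) + (q + u + u)
        regroup = solve-∀

[q+u]∸2∸[2+u]≡q∸4 : ∀ q u → q + u ∸ 2 ∸ (2 + u) ≡ q ∸ 4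
[q+u]∸2∸[2+u]≡q∸4 q u = begin
  q + u ∸ 2 ∸ (2 + u)  ≡⟨ ∸-+-assoc (q + u) 2 (2 + u) ⟩
  q + u ∸ (4 + u)      ≡⟨ cong₂ _∸_ (+-comm q u) (+-comm 4 u) ⟩
  u + q ∸ (u + 4)      ≡⟨ [m+n]∸[m+o]≡n∸o u q 4 ⟩
  q ∸ 4                ∎
  where open ≡-Reasoning

2+[q+u]∸[q+u+u∸[2+[q+u]]]≡4+q : ∀ q u → 2 ≤ u → 2 + (q + u) ∸ (q + u + u ∸ (2 + (q + u))) ≡ 4 + q
2+[q+u]∸[q+u+u∸[2+[q+u]]]≡4+q q u 2≤u = begin
  2 + (q + u) ∸ (q + u + u ∸ (2 + (q + u)))  ≡⟨ cong (2 + (q + u) ∸_) q+u+u∸[2+[q+u]]≡u∸2 ⟩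
  2 + (q + u) ∸ (u ∸ 2)                      ≡⟨ cong (λ x → 2 + (q + x) ∸ (u ∸ 2)) (sym (m+[n∸m]≡n 2≤u)) ⟩
  2 + (q + (2 + (u ∸ 2))) ∸ (u ∸ 2)          ≡⟨ cong (_∸ (u ∸ 2)) (regroup q (u ∸ 2)) ⟩
  4 + q + (u ∸ 2) ∸ (u ∸ 2)                  ≡⟨ m+n∸n≡m (4 + q) (u ∸ 2) ⟩
  4 + q                                      ∎
  where
  open ≡-Reasoning
  q+u+u∸[2+[q+u]]≡u∸2 : q + u + u ∸ (2 + (q + u)) ≡ u ∸ 2
  q+u+u∸[2+[q+u]]≡u∸2 = trans (cong (q + u + u ∸_) (+-comm 2 (q + u))) ([m+n]∸[m+o]≡n∸o (q + u) u 2)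
  regroup : ∀ q t → 2 + (q + (2 + t)) ≡ 4 + q + t
  regroup = solve-∀

≤⇒≤2* : ∀ {w r} → w ≤ r → w ≤ 2 * r
≤⇒≤2* {r = r} w≤r = ≤-trans w≤r (m≤m+n r (r + 0))

k+[v+u]≤2*[c+v] : ∀ {k c u v} → k ≤ c → u ≤ v → k + (v + u) ≤ 2 * (c + v)
k+[v+u]≤2*[c+v] {k} {c} {u} {v} k≤c u≤v = begin
  k + (v + u)      ≤⟨ +-mono-≤ k≤c (+-monoʳ-≤ v u≤v) ⟩
  c + (v + v)      ≤⟨ m≤m+n (c + (v + v)) c ⟩
  c + (v + v) + c  ≡⟨ regroup c v ⟩
  2 * (c + v)      ∎
  where
  open ≤-Reasoning
  regroup : ∀ c v → c + (v + v) + c ≡ 2 * (c + v)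
  regroup = solve-∀

c+q≤k+[q+u] : ∀ {c k} q u → c ≤ k → c + q ≤ k + (q + u)
c+q≤k+[q+u] q u c≤k = +-mono-≤ c≤k (m≤m+n q u)

c+[v+u]≰[c+k]+v : ∀ c {k u} v → k < u → ¬ c + (v + u) ≤ (c + k) + v
c+[v+u]≰[c+k]+v c {k} {u} v k<u = <⇒≱ (subst (_< c + (v + u)) (regroup c k v) (+-monoʳ-< c (+-monoʳ-< v k<u)))
  where regroup : ∀ c k v → c + (v + k) ≡ c + k + v
        regroup = solve-∀

arc-from-primes : ∀ k {x} → OddPrime x → OddPrime (k + (k + x)) → Arc k (k + x)
arc-from-primes k {x} x-prime sum-prime =
  sum-prime , m<m+n k (oddPrime⇒0< x-prime) , subst OddPrime (sym (m+n∸m≡n k x)) x-prime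

arc⇒oddPrime-difference : ∀ {q u} → Arc u (q + u) → OddPrime q
arc⇒oddPrime-difference {q} {u} (_ , _ , difference-prime) = subst OddPrime (m+n∸n≡m q u) difference-prime

arc⇒oddPrime-sum : ∀ {q u} → Arc u (q + u) → OddPrime (q + u + u)
arc⇒oddPrime-sum {q} {u} (sum-prime , _) = subst OddPrime (+-comm u (q + u)) sum-prime

arc⇒i<r : ∀ {r i u} → Arc u (r ∸ i) → i < r
arc⇒i<r (_ , u<r∸i , _) = m∸n≢0⇒n<m (m<n⇒n≢0 u<r∸i)

arc⇒∃[q]r≡i+[q+u] : ∀ {r i u} → Arc u (r ∸ i) → ∃[ q ] r ≡ i + (q + u)
arc⇒∃[q]r≡i+[q+u] {r} {i} {u} arc@(_ , u<r∸i , _) = r ∸ i ∸ u , (begin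
  r                      ≡⟨ m+[n∸m]≡n (<⇒≤ (arc⇒i<r {r} {i} arc)) ⟨
  i + (r ∸ i)            ≡⟨ cong (i +_) (m∸n+n≡m (<⇒≤ u<r∸i)) ⟨
  i + (r ∸ i ∸ u + u)    ∎)
  where open ≡-Reasoning

-- The pair (i , u) stands for the arc 2u → 2(r − i) counted in d⁻(2r − 2i).  A record rather
-- than a product, so that r and m can be inferred from IsInArc r m (i , u).
record IsInArc (r m : ℕ) (a : ℕ × ℕ) : Set where
  constructor inArc
  field
    index≤ : proj₁ a ≤ m
    arc    : Arc (proj₂ a) (r ∸ proj₁ a)

isInArc? : ∀ r m → Decidable (IsInArc r m)
isInArc? r m (i , u) = map′ (λ (i≤m , arc) → inArc i≤m arc) (λ (inArc i≤m arc) → i≤m , arc)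
                             ((i ≤? m) ×-dec arc? u (r ∸ i))

IsOutArc : ℕ → ℕ → ℕ × ℕ → Set
IsOutArc r m (j , w) = j ≤ m × w ≤ 2 * r × Arc j w

-- The value (0 , 0) on an exhausted list is junk; it is never reached from an out-arc in the image.
firstInArc : ℕ → ℕ → List (ℕ × ℕ) → ℕ × ℕ
firstInArc r m []       = 0 , 0
firstInArc r m (c ∷ cs) with isInArc? r m c
... | yes _ = c
... | no _  = firstInArc r m cs

-- Every candidate for the out-arc (j , w) shares one of the primes w ∓ j with it.  For w ≤ r the
-- first candidate is the arc itself, (r ∸ w , j); the candidate (i , r ∸ (c + w)) has smaller
-- prime w + c − i, and (i , (c + w) ∸ r), used when w > r, has larger prime w + c − i.  The order
-- of the candidates is the injection of in-arcs into out-arcs read backwards.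
belowCandidates : ℕ → ℕ → ℕ → List (ℕ × ℕ)
belowCandidates r 0 w = (0 , r ∸ w) ∷ (2 , r ∸ (2 + w)) ∷ (4 , r ∸ (4 + w)) ∷ []
belowCandidates r 2 w = (3 , r ∸ (1 + w)) ∷ (2 , r ∸ (4 + w)) ∷ []
belowCandidates r _ w = []

aboveCandidates : ℕ → ℕ → ℕ → List (ℕ × ℕ)
aboveCandidates r 0 w = (1 , (1 + w) ∸ r) ∷ (3 , (3 + w) ∸ r) ∷ []
aboveCandidates r 2 w = (4 , (2 + w) ∸ r) ∷ (2 , w ∸ r) ∷ []
aboveCandidates r 4 w = (4 , w ∸ r) ∷ []
aboveCandidates r _ w = []

candidates : ℕ → ℕ × ℕ → List (ℕ × ℕ)
candidates r (j , w) with w ≤? r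
... | yes _ = (r ∸ w , j) ∷ belowCandidates r j w
... | no _  = aboveCandidates r j w

recover : ℕ → ℕ → ℕ × ℕ → ℕ × ℕ
recover r m b = firstInArc r m (candidates r b)

data FirstInArc (r m : ℕ) : List (ℕ × ℕ) → ℕ × ℕ → Set where
  accept : ∀ {c a cs} → c ≡ a → IsInArc r m a → FirstInArc r m (c ∷ cs) a
  reject : ∀ {c a cs} → ¬ IsInArc r m c → FirstInArc r m cs a → FirstInArc r m (c ∷ cs) a

firstInArc-sound : ∀ {r m cs a} → FirstInArc r m cs a → firstInArc r m cs ≡ a
firstInArc-sound {r} {m} (accept {c} refl a-in) with isInArc? r m c
... | yes _    = refl
... | no a-out = contradiction a-in a-out
firstInArc-sound {r} {m} (reject {c} c-out first) with isInArc? r m c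
... | yes c-in = contradiction c-in c-out
... | no _     = firstInArc-sound first

recover-below : ∀ {r m j w a} → w ≤ r → FirstInArc r m ((r ∸ w , j) ∷ belowCandidates r j w) a →
                recover r m (j , w) ≡ a
recover-below {r} {w = w} w≤r first with w ≤? r
... | yes _   = firstInArc-sound first
... | no w≰r  = contradiction w≤r w≰r

recover-above : ∀ {r m j w a} → ¬ w ≤ r → FirstInArc r m (aboveCandidates r j w) a → recover r m (j , w) ≡ a
recover-above {r} {w = w} w≰r first with w ≤? r
... | yes w≤r = contradiction w≤r w≰r
... | no _    = firstInArc-sound first

reject-index : ∀ {r m i u} → ¬ i ≤ m → ¬ IsInArc r m (i , u)
reject-index i≰m (inArc i≤m _) = i≰m i≤m

reject-sum : ∀ {r m i u} → ¬ OddPrime (u + (r ∸ i)) → ¬ IsInArc r m (i , u)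
reject-sum ¬sum-prime (inArc _ (sum-prime , _)) = ¬sum-prime sum-prime

reject-difference : ∀ {r m i u} → (i ≤ m → ¬ OddPrime (r ∸ i ∸ u)) → ¬ IsInArc r m (i , u)
reject-difference ¬difference-prime (inArc i≤m (_ , _ , difference-prime)) = ¬difference-prime i≤m difference-prime

reject-centre : ∀ {r m j} k q {u} → m < u → ¬ IsInArc r m (k + (q + u) ∸ q , j)
reject-centre {m = m} k q {u} m<u =
  reject-index (subst (λ x → ¬ x ≤ m) (sym ([k+[q+u]]∸q≡k+u k q u)) (<⇒≱ (<-≤-trans m<u (m≤n+m u k))))

Preimage : ℕ → ℕ → ℕ × ℕ → Set
Preimage r m a = Σ[ b ∈ ℕ × ℕ ] IsOutArc r m b × recover r m b ≡ a

-- In the lemmas for u > m the centre is written r = i + (q + u), so that the in-arc has primes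
-- q and p = q + u + u, and r ∸ i and most candidates compute definitionally for a numeral i.
-- The suffix [j,w] names the out-arc (j , w) the in-arc is sent to.
module _ {m : ℕ} where

  centralPreimage : ∀ {r i u} → i ≤ m → u ≤ m → Arc u (r ∸ i) → Preimage r m (i , u)
  centralPreimage {r} {i} {u} i≤m u≤m arc =
    (u , r ∸ i) , (u≤m , ≤⇒≤2* (m∸n≤m r i) , arc) ,
    recover-below (m∸n≤m r i) (accept (cong (_, u) (m∸[m∸n]≡n (<⇒≤ (arc⇒i<r {r} {i} arc)))) (inArc i≤m arc))

  preimage₀[0,q] : ∀ {q u} → m < u → Arc u (q + u) → Preimage (q + u) m (0 , u)
  preimage₀[0,q] {q} {u} m<u arc =
    (0 , q) , (z≤n , ≤⇒≤2* q≤r , arc-from-primes 0 q-prime q-prime) ,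
    recover-below q≤r
      (reject (reject-centre 0 q m<u)
      (accept (cong (0 ,_) (m+n∸m≡n q u)) (inArc z≤n arc)))
    where q-prime : OddPrime q
          q-prime = arc⇒oddPrime-difference arc
          q≤r : q ≤ q + u
          q≤r = m≤m+n q u

  preimage₁[0,p] : ∀ {q u} → 1 ≤ m → m < u → Arc u (q + u) → Preimage (1 + (q + u)) m (1 , u)
  preimage₁[0,p] {q} {u} 1≤m m<u arc@(_ , u<q+u , _) =
    (0 , q + u + u) , (z≤n , k+[v+u]≤2*[c+v] {c = 1} z≤n (<⇒≤ u<q+u) , arc-from-primes 0 p-prime p-prime) ,
    recover-above (c+[v+u]≰[c+k]+v 0 (q + u) (≤-<-trans 1≤m m<u))
      (accept (cong (1 ,_) (m+n∸m≡n (q + u) u)) (inArc 1≤m arc))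
    where p-prime : OddPrime (q + u + u)
          p-prime = arc⇒oddPrime-sum arc

  preimage₂[0,q] : ∀ {q u} → 2 ≤ m → m < u → Arc u (q + u) → ¬ OddPrime (4 + (q + u + u)) →
                   Preimage (2 + (q + u)) m (2 , u)
  preimage₂[0,q] {q} {u} 2≤m m<u arc ¬p+4-prime =
    (0 , q) , (z≤n , ≤⇒≤2* q≤r , arc-from-primes 0 q-prime q-prime) ,
    recover-below q≤r
      (reject (reject-centre 2 q m<u)
      (reject (reject-sum (¬p+4-prime ∘ subst OddPrime ([k+[q+u]]∸q+[k+[q+u]]≡[k+k]+[q+u+u] 2 q u)))
      (accept (cong (2 ,_) (m+n∸m≡n q u)) (inArc 2≤m arc))))
    where q-prime : OddPrime q
          q-prime = arc⇒oddPrime-difference arc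
          q≤r : q ≤ 2 + (q + u)
          q≤r = c+q≤k+[q+u] {k = 2} q u z≤n

  -- Here q = 4 + s and the out-arc is (2 , q − 2).
  preimage₂[2,q-2] : ∀ {s u} → 4 ≤ m → m < u → Arc u (4 + s + u) → OddPrime s →
                     OddPrime (4 + (4 + s + u + u)) → Preimage (2 + (4 + s + u)) m (2 , u)
  preimage₂[2,q-2] {s} {u} 4≤m m<u arc s-prime p+4-prime =
    (2 , 2 + s) , (2≤m , ≤⇒≤2* w≤r , arc-from-primes 2 s-prime (arc⇒oddPrime-difference arc)) ,
    recover-below w≤r
      (reject (reject-centre 4 s m<u)
      (reject (reject-sum λ sum-prime → contradiction
                (oddPrimeTriple⇒≡3 (arc⇒oddPrime-sum arc)
                   (subst OddPrime ([k+[q+u]]∸q+[k+[q+u]]≡[k+k]+[q+u+u] 3 s u) sum-prime) p+4-prime) λ ())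
      (accept (cong (2 ,_) (m+n∸m≡n s u)) (inArc 2≤m arc))))
    where 2≤m : 2 ≤ m
          2≤m = ≤-trans (s≤s (s≤s z≤n)) 4≤m
          w≤r : 2 + s ≤ 6 + (s + u)
          w≤r = c+q≤k+[q+u] {k = 6} s u (s≤s (s≤s z≤n))

  preimage₂[2,p+2] : ∀ {q u} → 2 ≤ m → m < u → Arc u (q + u) → OddPrime (4 + (q + u + u)) →
                     ¬ (OddPrime (q ∸ 4) × 4 ≤ m) → Preimage (2 + (q + u)) m (2 , u)
  preimage₂[2,p+2] {q} {u} 2≤m m<u arc@(_ , u<q+u , _) p+4-prime ¬narrow =
    (2 , 2 + (q + u + u)) ,
    (2≤m , k+[v+u]≤2*[c+v] {c = 2} ≤-refl (<⇒≤ u<q+u) , arc-from-primes 2 (arc⇒oddPrime-sum arc) p+4-prime) ,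
    recover-above (c+[v+u]≰[c+k]+v 2 (q + u) (≤-<-trans z≤n m<u))
      (reject (reject-difference λ 4≤m difference-prime →
                ¬narrow (subst OddPrime difference≡q∸4 difference-prime , 4≤m))
      (accept (cong (2 ,_) (m+n∸m≡n (q + u) u)) (inArc 2≤m arc)))
    where difference≡q∸4 : q + u ∸ 2 ∸ (2 + (q + u + u) ∸ (q + u)) ≡ q ∸ 4
          difference≡q∸4 = trans (cong (q + u ∸ 2 ∸_) ([k+[q+u]]∸q≡k+u 2 (q + u) u)) ([q+u]∸2∸[2+u]≡q∸4 q u)

  preimage₂ : ∀ {q u} → 2 ≤ m → m < u → Arc u (q + u) → Preimage (2 + (q + u)) m (2 , u)
  preimage₂ {q} {u} 2≤m m<u arc with oddPrime? (4 + (q + u + u)) | oddPrime? (q ∸ 4) ×-dec (4 ≤? m)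
  ... | no ¬p+4-prime | _          = preimage₂[0,q] 2≤m m<u arc ¬p+4-prime
  ... | yes p+4-prime | no ¬narrow = preimage₂[2,p+2] 2≤m m<u arc p+4-prime ¬narrow
  ... | yes p+4-prime | yes (s-prime , 4≤m)
    with s , refl ← m≤n⇒∃[o]m+o≡n {4} {q} (<⇒≤ (m∸n≢0⇒n<m (m<n⇒n≢0 (oddPrime⇒0< s-prime))))
    = preimage₂[2,q-2] 4≤m m<u arc s-prime p+4-prime

  preimage₃[2,q+2] : ∀ {q u} → 3 ≤ m → m < u → Arc u (q + u) → OddPrime (4 + q) →
                     Preimage (3 + (q + u)) m (3 , u)
  preimage₃[2,q+2] {q} {u} 3≤m m<u arc q+4-prime =
    (2 , 2 + q) , (2≤m , ≤⇒≤2* w≤r , arc-from-primes 2 (arc⇒oddPrime-difference arc) q+4-prime) ,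
    recover-below w≤r
      (reject (reject-centre 1 q m<u)
      (accept (cong (3 ,_) (m+n∸m≡n q u)) (inArc 3≤m arc)))
    where 2≤m : 2 ≤ m
          2≤m = ≤-trans (n≤1+n 2) 3≤m
          w≤r : 2 + q ≤ 3 + (q + u)
          w≤r = c+q≤k+[q+u] {k = 3} q u (n≤1+n 2)

  preimage₃[0,p] : ∀ {q u} → 3 ≤ m → m < u → Arc u (q + u) → ¬ OddPrime (4 + q) →
                   Preimage (3 + (q + u)) m (3 , u)
  preimage₃[0,p] {q} {u} 3≤m m<u arc@(_ , u<q+u , _) ¬q+4-prime =
    (0 , q + u + u) , (z≤n , k+[v+u]≤2*[c+v] {c = 3} z≤n (<⇒≤ u<q+u) , arc-from-primes 0 p-prime p-prime) ,
    recover-above (c+[v+u]≰[c+k]+v 0 (q + u) 3<u)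
      (reject (reject-difference λ _ difference-prime →
                ¬q+4-prime (subst OddPrime (2+[q+u]∸[q+u+u∸[2+[q+u]]]≡4+q q u 2≤u) difference-prime))
      (accept (cong (3 ,_) (m+n∸m≡n (q + u) u)) (inArc 3≤m arc)))
    where p-prime : OddPrime (q + u + u)
          p-prime = arc⇒oddPrime-sum arc
          3<u : 3 < u
          3<u = ≤-<-trans 3≤m m<u
          2≤u : 2 ≤ u
          2≤u = ≤-trans (n≤1+n 2) (<⇒≤ 3<u)

  preimage₃ : ∀ {q u} → 3 ≤ m → m < u → Arc u (q + u) → Preimage (3 + (q + u)) m (3 , u)
  preimage₃ {q} 3≤m m<u arc with oddPrime? (4 + q)
  ... | yes q+4-prime = preimage₃[2,q+2] 3≤m m<u arc q+4-prime
  ... | no ¬q+4-prime = preimage₃[0,p] 3≤m m<u arc ¬q+4-prime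

  preimage₄[2,p+2] : ∀ {q u} → 4 ≤ m → m < u → Arc u (q + u) → OddPrime (4 + (q + u + u)) →
                     Preimage (4 + (q + u)) m (4 , u)
  preimage₄[2,p+2] {q} {u} 4≤m m<u arc@(_ , u<q+u , _) p+4-prime =
    (2 , 2 + (q + u + u)) ,
    (2≤m , k+[v+u]≤2*[c+v] {c = 4} 2≤4 (<⇒≤ u<q+u) , arc-from-primes 2 (arc⇒oddPrime-sum arc) p+4-prime) ,
    recover-above (c+[v+u]≰[c+k]+v 2 (q + u) (<-≤-trans (s≤s 2≤4) (≤-<-trans 4≤m m<u)))
      (accept (cong (4 ,_) (m+n∸m≡n (q + u) u)) (inArc 4≤m arc))
    where 2≤4 : 2 ≤ 4
          2≤4 = s≤s (s≤s z≤n)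
          2≤m : 2 ≤ m
          2≤m = ≤-trans 2≤4 4≤m

  preimage₄[4,p+4] : ∀ {q u} → 4 ≤ m → m < u → Arc u (q + u) → OddPrime (8 + (q + u + u)) →
                     Preimage (4 + (q + u)) m (4 , u)
  preimage₄[4,p+4] {q} {u} 4≤m m<u arc@(_ , u<q+u , _) p+8-prime =
    (4 , 4 + (q + u + u)) ,
    (4≤m , k+[v+u]≤2*[c+v] {c = 4} ≤-refl (<⇒≤ u<q+u) , arc-from-primes 4 (arc⇒oddPrime-sum arc) p+8-prime) ,
    recover-above (c+[v+u]≰[c+k]+v 4 (q + u) (≤-<-trans z≤n m<u))
      (accept (cong (4 ,_) (m+n∸m≡n (q + u) u)) (inArc 4≤m arc))

  preimage₄[0,q] : ∀ {q u} → 4 ≤ m → m < u → Arc u (q + u) →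
                   ¬ OddPrime (4 + (q + u + u)) → ¬ OddPrime (8 + (q + u + u)) →
                   Preimage (4 + (q + u)) m (4 , u)
  preimage₄[0,q] {q} {u} 4≤m m<u arc ¬p+4-prime ¬p+8-prime =
    (0 , q) , (z≤n , ≤⇒≤2* q≤r , arc-from-primes 0 q-prime q-prime) ,
    recover-below q≤r
      (reject (reject-centre 4 q m<u)
      (reject (reject-sum (¬p+8-prime ∘ subst OddPrime ([k+[q+u]]∸q+[k+[q+u]]≡[k+k]+[q+u+u] 4 q u)))
      (reject (reject-sum (¬p+4-prime ∘ subst OddPrime ([k+[q+u]]∸q+[k+[q+u]]≡[k+k]+[q+u+u] 2 q u)))
      (accept (cong (4 ,_) (m+n∸m≡n q u)) (inArc 4≤m arc)))))
    where q-prime : OddPrime q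
          q-prime = arc⇒oddPrime-difference arc
          q≤r : q ≤ 4 + (q + u)
          q≤r = c+q≤k+[q+u] {k = 4} q u z≤n

  preimage₄ : ∀ {q u} → 4 ≤ m → m < u → Arc u (q + u) → Preimage (4 + (q + u)) m (4 , u)
  preimage₄ {q} {u} 4≤m m<u arc with oddPrime? (4 + (q + u + u)) | oddPrime? (8 + (q + u + u))
  ... | yes p+4-prime | _             = preimage₄[2,p+2] 4≤m m<u arc p+4-prime
  ... | no ¬p+4-prime | yes p+8-prime = preimage₄[4,p+4] 4≤m m<u arc p+8-prime
  ... | no ¬p+4-prime | no ¬p+8-prime = preimage₄[0,q] 4≤m m<u arc ¬p+4-prime ¬p+8-prime

  farPreimage : ∀ i {q u} → m ≤ 4 → i ≤ m → m < u → Arc u (i + (q + u) ∸ i) →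
                Preimage (i + (q + u)) m (i , u)
  farPreimage 0 _   _   m<u arc = preimage₀[0,q] m<u arc
  farPreimage 1 _   i≤m m<u arc = preimage₁[0,p] i≤m m<u arc
  farPreimage 2 _   i≤m m<u arc = preimage₂ i≤m m<u arc
  farPreimage 3 _   i≤m m<u arc = preimage₃ i≤m m<u arc
  farPreimage 4 _   i≤m m<u arc = preimage₄ i≤m m<u arc
  farPreimage (suc (suc (suc (suc (suc i))))) m≤4 i≤m _ _ =
    contradiction (≤-trans i≤m m≤4) λ { (s≤s (s≤s (s≤s (s≤s ())))) }

  preimage : ∀ {r i u} → m ≤ 4 → i ≤ m → Arc u (r ∸ i) → Preimage r m (i , u)
  preimage {r} {i} {u} m≤4 i≤m arc with u ≤? m
  ... | yes u≤m = centralPreimage i≤m u≤m arc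
  ... | no u≰m with _ , refl ← arc⇒∃[q]r≡i+[q+u] {r} {i} arc = farPreimage i m≤4 i≤m (≰⇒> u≰m) arc

indegShift≤indeg : ∀ n r i → indegShift n r i ≤ indeg n (r ∸ i)
indegShift≤indeg n r i with i ≤? r
... | yes _ = ≤-refl
... | no _  = z≤n

inArc? : ∀ r (a : ℕ × ℕ) → Dec (Arc (proj₂ a) (r ∸ proj₁ a))
inArc? r a = arc? (proj₂ a) (r ∸ proj₁ a)

outArc? : ∀ (b : ℕ × ℕ) → Dec (Arc (proj₁ b) (proj₂ b))
outArc? b = arc? (proj₁ b) (proj₂ b)

inArcs : ℕ → ℕ → ℕ → List (ℕ × ℕ)
inArcs n r m = filter (inArc? r) (cartesianProduct (upTo (suc m)) (vertices n))

outArcs : ℕ → ℕ → List (ℕ × ℕ)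
outArcs n m = filter outArc? (cartesianProduct (upTo (suc m)) (vertices n))

length-inArcs : ∀ n r m → length (inArcs n r m) ≡ sum (map (λ i → indeg n (r ∸ i)) (upTo (suc m)))
length-inArcs n r m = length-filter-cartesianProduct (inArc? r) (upTo (suc m)) (vertices n)

length-outArcs : ∀ n m → length (outArcs n m) ≡ sumTo m (outdeg n)
length-outArcs n m = length-filter-cartesianProduct outArc? (upTo (suc m)) (vertices n)

inArcs⊆recover[outArcs] : ∀ n r m → 2 * r ≤ n → m ≤ 4 → inArcs n r m ⊆ map (recover r m) (outArcs n m)
inArcs⊆recover[outArcs] n r m 2r≤n m≤4 a∈inArcs
  with a∈product , arc ← ∈-filter⁻ (inArc? r) {xs = cartesianProduct (upTo (suc m)) (vertices n)} a∈inArcs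
  with i∈indices , _ ← ∈-cartesianProduct⁻ (upTo (suc m)) (vertices n) a∈product
  with b , (j≤m , w≤2r , out-arc) , recovers ← preimage m≤4 (≤-pred (∈-upTo⁻ i∈indices)) arc
  = ∈-map∘filter⁺ (recover r m) outArc?
      (b , ∈-cartesianProduct⁺ (∈-upTo⁺ (s≤s j≤m)) (∈-upTo⁺ (s≤s (≤-trans w≤2r 2r≤n))) , sym recovers , out-arc)

length-inArcs≤length-outArcs : ∀ n r m → 2 * r ≤ n → m ≤ 4 → length (inArcs n r m) ≤ length (outArcs n m)
length-inArcs≤length-outArcs n r m 2r≤n m≤4 = begin
  length (inArcs n r m)                     ≤⟨ Unique∧⊆⇒length≤ (≡-dec _≟_ _≟_) unique
                                                  (inArcs⊆recover[outArcs] n r m 2r≤n m≤4) ⟩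
  length (map (recover r m) (outArcs n m))  ≡⟨ length-map (recover r m) (outArcs n m) ⟩
  length (outArcs n m)                      ∎
  where
  open ≤-Reasoning
  unique : Unique (inArcs n r m)
  unique = filter⁺ (inArc? r) (cartesianProduct⁺ (upTo⁺ (suc m)) (upTo⁺ (suc n)))

mainTheorem9 : (r n m : ℕ) → 1 ≤ r → 1 ≤ n → 2 * r ≤ n → m ≤ 4 →
    sumTo m (λ i → indegShift n r i) ≤ sumTo m (λ i → outdeg n i)
mainTheorem9 r n m _ _ 2r≤n m≤4 = begin
  sumTo m (λ i → indegShift n r i)                 ≤⟨ sum-map-mono (indegShift≤indeg n r) (upTo (suc m)) ⟩
  sum (map (λ i → indeg n (r ∸ i)) (upTo (suc m))) ≡⟨ length-inArcs n r m ⟨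
  length (inArcs n r m)                            ≤⟨ length-inArcs≤length-outArcs n r m 2r≤n m≤4 ⟩
  length (outArcs n m)                             ≡⟨ length-outArcs n m ⟩
  sumTo m (λ i → outdeg n i)                       ∎
  where open ≤-Reasoning
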